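{- Let $n$ be an odd positive integer and let $P_n$ be the path on $n$ vertices. Then $\gamma'_{\rm SMB}(P_n)=\lfloor \log_2 n\rfloor+1$. Moreover, Staller has a strategy in the S-game on $P_n$ which, against every strategy of Dominator, wins after she has played at most $\lfloor \log_2 n\rfloor+1$ vertices, such that the closed neighborhood she claims is $N[v]$ for a vertex $v$ at even distance from the ends of the path.
   Context: All graphs are finite and simple; $N_G[v]=N_G(v)\cup\{v\}$ is the closed neighborhood of $v$. The Maker-Breaker domination game on a graph $G$ is played by two players, Dominator and Staller, who alternately choose (play) a vertex of $G$ that has not been played before. Dominator wins if the set of vertices he has played is a dominating set of $G$; Staller wins (claims $N_G[v]$) if she has played all vertices of $N_G[v]$ for some vertex $v\in V(G)$. In the S-game Staller makes the first move. $\gamma'_{\rm SMB}(G)$ is the smallest integer $k$ such that in the S-game, under any strategy of Dominator, Staller can win having played at most $k$ vertices ($\infty$ if Staller has no winning strategy). -}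

module Defs where

open import Level using (0ℓ)
open import Data.Nat using (ℕ; zero; suc; _+_; _*_; _∸_; _<_)
open import Data.Fin using (Fin; toℕ)
open import Data.Fin.Subset using (Subset; _∈_; _∉_; _∪_; ⁅_⁆; ⊥)
open import Data.Product using (Σ; ∃; _×_; _,_)
open import Data.Sum using (_⊎_)
open import Relation.Nullary using (¬_)
open import Relation.Binary.PropositionalEquality using (_≡_)

record Graph : Set₁ where
  field
    order : ℕ
    Adj   : Fin order → Fin order → Set
    sym   : ∀ {u v} → Adj u v → Adj v u
    irrefl : ∀ {v} → ¬ Adj v v
open Graph public

InClosedNbhd : (G : Graph) → Fin (order G) → Fin (order G) → Set
InClosedNbhd G v u = u ≡ v ⊎ Adj G v u

Claims : (G : Graph) → (Fin (order G) → Set) → Subset (order G) → Set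
Claims G P S = ∃ λ v → P v × (∀ u → InClosedNbhd G v u → u ∈ S)

Free : (G : Graph) → Subset (order G) → Subset (order G) → Fin (order G) → Set
Free G D S x = x ∉ D × x ∉ S

-- StallerWins G P k D S : position where Dominator has played D, Staller has
-- played S, no closed neighbourhood is claimed yet, and it is Staller's move.
-- If after Staller's move the board is full and she has not won, the game is
-- over and Dominator has won (his set then dominates G); hence the requirement
-- that a free vertex remain for Dominator.
StallerWins : (G : Graph) → (Fin (order G) → Set) → ℕ →
              Subset (order G) → Subset (order G) → Set
StallerWins G P zero    D S = Data.Empty.⊥
  where import Data.Empty
StallerWins G P (suc k) D S =
  ∃ λ x → Free G D S x ×
    ( Claims G P (S ∪ ⁅ x ⁆)
    ⊎ ( (∃ λ y → Free G D (S ∪ ⁅ x ⁆) y)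
      × (∀ y → Free G D (S ∪ ⁅ x ⁆) y →
           StallerWins G P k (D ∪ ⁅ y ⁆) (S ∪ ⁅ x ⁆))))

SGameWinWithin : (G : Graph) → (Fin (order G) → Set) → ℕ → Set
SGameWinWithin G P k = StallerWins G P k ⊥ ⊥

γ'SMB≡ : Graph → ℕ → Set
γ'SMB≡ G k = SGameWinWithin G (λ _ → Data.Unit.⊤) k
           × (∀ j → j < k → ¬ SGameWinWithin G (λ _ → Data.Unit.⊤) j)
  where import Data.Unit

PathAdj : (n : ℕ) → Fin n → Fin n → Set
PathAdj n u v = suc (toℕ u) ≡ toℕ v ⊎ suc (toℕ v) ≡ toℕ u

Path : ℕ → Graph
Path n = record { order = n ; Adj = PathAdj n ; sym = s ; irrefl = i }
  where
  open import Data.Sum using (inj₁; inj₂)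
  open import Data.Nat.Properties using (1+n≢n)
  s : ∀ {u v} → PathAdj n u v → PathAdj n v u
  s (inj₁ e) = inj₂ e
  s (inj₂ e) = inj₁ e
  i : ∀ {v} → ¬ PathAdj n v v
  i {v} (inj₁ e) = 1+n≢n e
  i {v} (inj₂ e) = 1+n≢n e

Even : ℕ → Set
Even m = ∃ λ k → m ≡ 2 * k

Odd : ℕ → Set
Odd m = ∃ λ k → m ≡ suc (2 * k)

EvenFromEnds : (n : ℕ) → Fin n → Set
EvenFromEnds n v = Even (toℕ v) × Even (n ∸ 1 ∸ toℕ v)

-- Write n = 2m+1.
-- Staller bisects: she keeps a stretch of candidate centres 2p, …, 2(p+t) that is still
-- vacant and whose two outer neighbours she already holds, plays the odd vertex in its
-- middle, and keeps the half away from Dominator's answer.  After ⌊log₂ n⌋ halvings a single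
-- candidate 2p is left, and her next move claims N[2p].
-- Dominator pairs {2j, 2j+1} to the left and {2j+1, 2j+2} to the right of a gap of even
-- vertices untouched by Staller, and answers a move in a pair with its partner; then every
-- N[v] away from the gap keeps a pair Staller cannot complete in one move.  A move in the
-- gap is answered next to it: at an even vertex this dominates it for good, at an odd one
-- the longer side remains a gap.  So a gap of 2w+1 ≥ 2^k vertices survives k Staller moves,
-- and initially the whole path, with 2^⌊log₂ n⌋ ≤ n vertices, is the gap.

module Submission where

open import Data.Bool using (Bool; true; false)
open import Data.Empty using (⊥-elim)
open import Data.Fin using (Fin; zero; suc; toℕ; fromℕ<)
open import Data.Fin.Properties using (toℕ-fromℕ<; toℕ-injective; toℕ<n)
open import Data.Fin.Subset using (Subset; _∈_; _∉_; _∪_; _⊆_; ⁅_⁆; ⊥)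
open import Data.Fin.Subset.Properties using (∉⊥; p⊆p∪q; x∈p∪q⁺; x∈p∪q⁻; x∈⁅x⁆; x∈⁅y⁆⇒x≡y)
open import Data.Nat
  using (ℕ; zero; suc; _+_; _*_; _∸_; _^_; _≤_; _<_; z≤n; s≤s; s≤s⁻¹; pred; ⌊_/2⌋; ⌈_/2⌉; _≟_; _<?_; _≤?_)
open import Data.Nat.Induction using (<-rec)
open import Data.Nat.Logarithm using (⌊log₂_⌋; ⌊log₂⌋-mono-≤; ⌊log₂⌊n/2⌋⌋≡⌊log₂n⌋∸1; ⌊log₂[2^n]⌋≡n)
open import Data.Nat.Properties
open import Data.Product using (∃; _×_; _,_)
open import Data.Sum using (_⊎_; inj₁; inj₂)
open import Data.Unit using (tt)
open import Data.Vec using ([]; _∷_; here; there)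
open import Relation.Binary.Definitions using (tri<; tri≈; tri>)
open import Relation.Binary.PropositionalEquality
open import Relation.Nullary using (¬_; yes; no)
open import Function using (_∘_)

open import Defs hiding (sym)

-- Subsets indexed by natural numbers; indices past the end are never members.
at : ∀ {n} → Subset n → ℕ → Bool
at []      _       = false
at (b ∷ p) zero    = b
at (b ∷ p) (suc i) = at p i

∈⇒at : ∀ {n} {p : Subset n} {x} → x ∈ p → at p (toℕ x) ≡ true
∈⇒at here      = refl
∈⇒at (there x) = ∈⇒at x

at⇒∈ : ∀ {n} (p : Subset n) x → at p (toℕ x) ≡ true → x ∈ p
at⇒∈ (true ∷ p) zero    refl = here
at⇒∈ (b ∷ p)    (suc x) e    = there (at⇒∈ p x e)

∉⇒at : ∀ {n} {p : Subset n} {x} → x ∉ p → at p (toℕ x) ≡ false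
∉⇒at {p = p} {x} x∉p with at p (toℕ x) in e
... | true  = ⊥-elim (x∉p (at⇒∈ p x e))
... | false = refl

at⇒< : ∀ {n} (p : Subset n) {i} → at p i ≡ true → i < n
at⇒< (b ∷ p) {zero}  _ = s≤s z≤n
at⇒< (b ∷ p) {suc i} e = s≤s (at⇒< p e)

at-fromℕ< : ∀ {n} (p : Subset n) {i} (i<n : i < n) → at p (toℕ (fromℕ< i<n)) ≡ at p i
at-fromℕ< p i<n = cong (at p) (toℕ-fromℕ< i<n)

at-⊆ : ∀ {n} {p q : Subset n} {i} → p ⊆ q → at p i ≡ true → at q i ≡ true
at-⊆ {p = p} {q} p⊆q e =
  trans (sym (at-fromℕ< q i<n)) (∈⇒at (p⊆q (at⇒∈ p _ (trans (at-fromℕ< p i<n) e))))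
  where i<n = at⇒< p e

at-⊥ : ∀ {n} i → at (⊥ {n}) i ≡ false
at-⊥ {zero}  _       = refl
at-⊥ {suc n} zero    = refl
at-⊥ {suc n} (suc i) = at-⊥ {n} i

at-⁅⁆-miss : ∀ {n} (y : Fin n) {i} → toℕ y ≢ i → at ⁅ y ⁆ i ≡ false
at-⁅⁆-miss         zero    {zero}  y≢i = ⊥-elim (y≢i refl)
at-⁅⁆-miss {suc n} zero    {suc i} _   = at-⊥ {n} i
at-⁅⁆-miss         (suc y) {zero}  _   = refl
at-⁅⁆-miss         (suc y) {suc i} y≢i = at-⁅⁆-miss y (y≢i ∘ cong suc)

at-∪-miss : ∀ {n} (p q : Subset n) {i} → at p i ≡ false → at q i ≡ false → at (p ∪ q) i ≡ false
at-∪-miss []      []      _    _ = refl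
at-∪-miss (a ∷ p) (b ∷ q) {zero}  refl refl = refl
at-∪-miss (a ∷ p) (b ∷ q) {suc i} e    e′   = at-∪-miss p q e e′

at-∪⁅⁆-hit : ∀ {n} (p : Subset n) {y i} → toℕ y ≡ i → at (p ∪ ⁅ y ⁆) i ≡ true
at-∪⁅⁆-hit p {y} refl = ∈⇒at {p = p ∪ ⁅ y ⁆} (x∈p∪q⁺ (inj₂ (x∈⁅x⁆ y)))

at-∪⁅⁆-miss : ∀ {n} {p : Subset n} {y i} → at p i ≡ false → toℕ y ≢ i → at (p ∪ ⁅ y ⁆) i ≡ false
at-∪⁅⁆-miss {p = p} {y} e y≢i = at-∪-miss p ⁅ y ⁆ e (at-⁅⁆-miss y y≢i)

true≢false : true ≢ false
true≢false ()

free : ∀ {n} → Subset n → Subset n → ℕ → Set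
free D S i = at D i ≡ false × at S i ≡ false

free-fromℕ< : ∀ {n} {D S : Subset n} {i} (i<n : i < n) → free D S i →
              fromℕ< i<n ∉ D × fromℕ< i<n ∉ S
free-fromℕ< {D = D} {S} i<n (d , s) =
  (λ ∈D → true≢false (trans (sym (∈⇒at ∈D)) (trans (at-fromℕ< D i<n) d))) ,
  (λ ∈S → true≢false (trans (sym (∈⇒at ∈S)) (trans (at-fromℕ< S i<n) s)))

free-playS : ∀ {n} {D S : Subset n} {x i} → free D S i → toℕ x ≢ i → free D (S ∪ ⁅ x ⁆) i
free-playS {S = S} (d , s) x≢i = d , at-∪⁅⁆-miss {p = S} s x≢i

free-∪⁅⁆ : ∀ {n} {D S : Subset n} {x y i} → free D S i → toℕ x ≢ i → toℕ y ≢ i →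
           free (D ∪ ⁅ y ⁆) (S ∪ ⁅ x ⁆) i
free-∪⁅⁆ {D = D} {S} (d , s) x≢i y≢i = at-∪⁅⁆-miss {p = D} d y≢i , at-∪⁅⁆-miss {p = S} s x≢i

parity : ∀ i → Even i ⊎ Odd i
parity zero    = inj₁ (0 , refl)
parity (suc i) with parity i
... | inj₁ (j , refl) = inj₂ (j , refl)
... | inj₂ (j , refl) = inj₁ (suc j , sym (*-suc 2 j))

m<n⇒1+2m<2n : ∀ {m n} → m < n → suc (2 * m) < 2 * n
m<n⇒1+2m<2n {m} {n} m<n = subst (_≤ 2 * n) (*-suc 2 m) (*-monoʳ-≤ 2 m<n)

1+2m≤2n⇒m<n : ∀ {m n} → suc (2 * m) ≤ 2 * n → m < n
1+2m≤2n⇒m<n {m} {n} = *-cancelˡ-< 2 m n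

2m<1+2n⇒m≤n : ∀ {m n} → 2 * m < suc (2 * n) → m ≤ n
2m<1+2n⇒m≤n 2m<1+2n = *-cancelˡ-≤ 2 (s≤s⁻¹ 2m<1+2n)

2m≤1+2n⇒m≤n : ∀ {m n} → 2 * m ≤ suc (2 * n) → m ≤ n
2m≤1+2n⇒m≤n {m} {n} 2m≤1+2n with m≤n⇒m<n∨m≡n 2m≤1+2n
... | inj₁ 2m<1+2n = 2m<1+2n⇒m≤n 2m<1+2n
... | inj₂ 2m≡1+2n = ⊥-elim (even≢odd m n 2m≡1+2n)

longer-half : ∀ {k s r} → 2 ^ suc k ≤ suc (2 * suc (s + r)) → r ≤ s → 2 ^ k ≤ suc (2 * s)
longer-half {k} {s} {r} long r≤s = 2m≤1+2n⇒m≤n (begin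
  2 * 2 ^ k               ≤⟨ long ⟩
  suc (2 * suc (s + r))   ≤⟨ s≤s (*-monoʳ-≤ 2 (s≤s (+-monoʳ-≤ s r≤s))) ⟩
  suc (2 * suc (s + s))   ≡⟨ cong (λ h → suc (2 * suc (s + h))) (sym (+-identityʳ s)) ⟩
  suc (2 * suc (2 * s))   ∎)
  where open ≤-Reasoning

2^[1+k]≤1+2w⇒0<w : ∀ {k w} → 2 ^ suc k ≤ suc (2 * w) → 0 < w
2^[1+k]≤1+2w⇒0<w {k} {w = zero}  long = ⊥-elim (<⇒≱ (*-monoʳ-≤ 2 (m^n>0 2 k)) long)
2^[1+k]≤1+2w⇒0<w     {w = suc w} _    = s≤s z≤n

Outside : ℕ → ℕ → ℕ → Set
Outside lo hi v = v < lo ⊎ hi < v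

Outside⇒≢ : ∀ {lo hi v i} → Outside lo hi v → lo ≤ i → i ≤ hi → v ≢ i
Outside⇒≢ (inj₁ v<lo) lo≤i _ refl = <⇒≱ v<lo lo≤i
Outside⇒≢ (inj₂ hi<v) _ i≤hi refl = <⇒≱ hi<v i≤hi

2*⌊n/2⌋≤n : ∀ n → 2 * ⌊ n /2⌋ ≤ n
2*⌊n/2⌋≤n zero          = z≤n
2*⌊n/2⌋≤n (suc zero)    = z≤n
2*⌊n/2⌋≤n (suc (suc n)) =
  subst (_≤ suc (suc n)) (sym (*-suc 2 ⌊ n /2⌋)) (s≤s (s≤s (2*⌊n/2⌋≤n n)))

n<2*m⇒⌊n/2⌋<m : ∀ {n m} → n < 2 * m → ⌊ n /2⌋ < m
n<2*m⇒⌊n/2⌋<m {n} {m} n<2m = *-cancelˡ-< 2 ⌊ n /2⌋ m (≤-<-trans (2*⌊n/2⌋≤n n) n<2m)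

⌊log₂n⌋≡1+⌊log₂⌊n/2⌋⌋ : ∀ n → 2 ≤ n → ⌊log₂ n ⌋ ≡ suc ⌊log₂ ⌊ n /2⌋ ⌋
⌊log₂n⌋≡1+⌊log₂⌊n/2⌋⌋ n 2≤n = begin
  ⌊log₂ n ⌋             ≡⟨ sym (m+[n∸m]≡n 1≤⌊log₂n⌋) ⟩
  suc (⌊log₂ n ⌋ ∸ 1)   ≡⟨ cong suc (sym (⌊log₂⌊n/2⌋⌋≡⌊log₂n⌋∸1 n)) ⟩
  suc ⌊log₂ ⌊ n /2⌋ ⌋   ∎
  where
  open ≡-Reasoning
  1≤⌊log₂n⌋ : 1 ≤ ⌊log₂ n ⌋
  1≤⌊log₂n⌋ = subst (_≤ ⌊log₂ n ⌋) (⌊log₂[2^n]⌋≡n 1) (⌊log₂⌋-mono-≤ 2≤n)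

2^⌊log₂n⌋≤n : ∀ n → 1 ≤ n → 2 ^ ⌊log₂ n ⌋ ≤ n
2^⌊log₂n⌋≤n = <-rec (λ n → 1 ≤ n → 2 ^ ⌊log₂ n ⌋ ≤ n) bound
  where
  bound : ∀ n → (∀ {h} → h < n → 1 ≤ h → 2 ^ ⌊log₂ h ⌋ ≤ h) → 1 ≤ n → 2 ^ ⌊log₂ n ⌋ ≤ n
  bound (suc zero)    _   _ = subst (λ L → 2 ^ L ≤ 1) (sym (⌊log₂[2^n]⌋≡n 0)) ≤-refl
  bound (suc (suc n)) rec _ = begin
    2 ^ ⌊log₂ (2 + n) ⌋          ≡⟨ cong (2 ^_) (⌊log₂n⌋≡1+⌊log₂⌊n/2⌋⌋ (2 + n) (s≤s (s≤s z≤n))) ⟩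
    2 * 2 ^ ⌊log₂ ⌊ 2 + n /2⌋ ⌋  ≤⟨ *-monoʳ-≤ 2 (rec (⌊n/2⌋<n (suc n)) (s≤s z≤n)) ⟩
    2 * ⌊ 2 + n /2⌋              ≤⟨ 2*⌊n/2⌋≤n (2 + n) ⟩
    2 + n                        ∎
    where open ≤-Reasoning

n<2^[1+⌊log₂n⌋] : ∀ n → n < 2 ^ suc ⌊log₂ n ⌋
n<2^[1+⌊log₂n⌋] n with n <? 2 ^ suc ⌊log₂ n ⌋
... | yes n<2^[1+L] = n<2^[1+L]
... | no  n≮2^[1+L] = ⊥-elim (<-irrefl refl (subst (_≤ ⌊log₂ n ⌋) (⌊log₂[2^n]⌋≡n (suc ⌊log₂ n ⌋))
                                                    (⌊log₂⌋-mono-≤ (≮⇒≥ n≮2^[1+L]))))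

StallerWins-mono : ∀ {G : Graph} {P Q : Fin (order G) → Set} → (∀ {v} → P v → Q v) →
                   ∀ {k D S} → StallerWins G P k D S → StallerWins G Q k D S
StallerWins-mono P⇒Q {suc k} (x , fx , inj₁ (v , Pv , claimed)) = x , fx , inj₁ (v , P⇒Q Pv , claimed)
StallerWins-mono P⇒Q {suc k} (x , fx , inj₂ (reply , wins)) =
  x , fx , inj₂ (reply , λ y fy → StallerWins-mono P⇒Q (wins y fy))

Disjoint : ∀ {n} → Subset n → Subset n → Set
Disjoint D S = ∀ {v} → v ∈ D → v ∉ S

Disjoint-play : ∀ {G : Graph} {D S : Subset (order G)} {x y} → Disjoint D S →
                Free G D S x → Free G D (S ∪ ⁅ x ⁆) y → Disjoint (D ∪ ⁅ y ⁆) (S ∪ ⁅ x ⁆)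
Disjoint-play {D = D} {S} {x} {y} D∩S=∅ (x∉D , _) (_ , y∉S′) v∈D′ v∈S′ with x∈p∪q⁻ D ⁅ y ⁆ v∈D′
... | inj₂ v∈⁅y⁆ rewrite x∈⁅y⁆⇒x≡y y v∈⁅y⁆ = y∉S′ v∈S′
... | inj₁ v∈D with x∈p∪q⁻ S ⁅ x ⁆ v∈S′
...   | inj₁ v∈S   = D∩S=∅ v∈D v∈S
...   | inj₂ v∈⁅x⁆ rewrite x∈⁅y⁆⇒x≡y x v∈⁅x⁆ = x∉D v∈D

Disjoint-at : ∀ {n} {D S : Subset n} {u} → Disjoint D S → at D u ≡ true → at S u ≡ false
Disjoint-at {D = D} {S} D∩S=∅ u∈D =
  trans (sym (at-fromℕ< S u<n)) (∉⇒at (D∩S=∅ (at⇒∈ D _ (trans (at-fromℕ< D u<n) u∈D))))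
  where u<n = at⇒< D u∈D

module _ (G : Graph) (P : Fin (order G) → Set) (Safe : ℕ → Subset (order G) → Subset (order G) → Set)
  (blocks : ∀ {k D S} → Disjoint D S → Safe (suc k) D S →
            ∀ x → Free G D S x → ¬ Claims G P (S ∪ ⁅ x ⁆))
  (reply : ∀ {k D S} → Safe (suc k) D S → ∀ x → Free G D S x → (∃ λ y → Free G D (S ∪ ⁅ x ⁆) y) →
           ∃ λ y → Free G D (S ∪ ⁅ x ⁆) y × Safe k (D ∪ ⁅ y ⁆) (S ∪ ⁅ x ⁆))
  where

  Safe⇒¬StallerWins : ∀ k {D S} → Disjoint D S → Safe k D S → ¬ StallerWins G P k D S
  Safe⇒¬StallerWins zero    _     _    ()
  Safe⇒¬StallerWins (suc k) D∩S=∅ safe (x , fx , inj₁ claimed) = blocks D∩S=∅ safe x fx claimed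
  Safe⇒¬StallerWins (suc k) D∩S=∅ safe (x , fx , inj₂ (replies , wins))
    with reply safe x fx replies
  ... | y , fy , safe′ = Safe⇒¬StallerWins k (Disjoint-play {G = G} D∩S=∅ fx fy) safe′ (wins y fy)

module Bisection (m : ℕ) where

  n : ℕ
  n = suc (2 * m)

  Vacant : Subset n → Subset n → ℕ → ℕ → Set
  Vacant D S lo hi = ∀ {i} → lo ≤ i → i ≤ hi → free D S i

  Vacant-play : ∀ {D S x y lo hi lo′ hi′} → Vacant D S lo hi → lo ≤ lo′ → hi′ ≤ hi →
                Outside lo′ hi′ (toℕ x) → Outside lo′ hi′ (toℕ y) →
                Vacant (D ∪ ⁅ y ⁆) (S ∪ ⁅ x ⁆) lo′ hi′
  Vacant-play {D} {S} vacant lo≤lo′ hi′≤hi x-out y-out lo′≤i i≤hi′ =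
    free-∪⁅⁆ {D = D} {S} (vacant (≤-trans lo≤lo′ lo′≤i) (≤-trans i≤hi′ hi′≤hi))
             (Outside⇒≢ x-out lo′≤i i≤hi′) (Outside⇒≢ y-out lo′≤i i≤hi′)

  record Bracket (k : ℕ) (D S : Subset n) : Set where
    constructor bracket
    field
      p t       : ℕ
      p+t≤m     : p + t ≤ m
      t<2^k     : t < 2 ^ k
      vacant    : Vacant D S (2 * p) (2 * (p + t))
      left-wall  : p ≡ 0 ⊎ at S (pred (2 * p)) ≡ true
      right-wall : p + t ≡ m ⊎ at S (suc (2 * (p + t))) ≡ true

  EvenFromEnds-2* : ∀ {p} → p ≤ m → (x : Fin n) → toℕ x ≡ 2 * p → EvenFromEnds n x
  EvenFromEnds-2* {p} _ x x≡2p =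
    (p , x≡2p) , (m ∸ p , trans (cong (2 * m ∸_) x≡2p) (sym (*-distribˡ-∸ 2 m p)))

  claim-walled : ∀ {k D S} p → p ≤ m → free D S (2 * p) →
                 (p ≡ 0 ⊎ at S (pred (2 * p)) ≡ true) → (p ≡ m ⊎ at S (suc (2 * p)) ≡ true) →
                 StallerWins (Path n) (EvenFromEnds n) (suc k) D S
  claim-walled {S = S} p p≤m vacant left-wall right-wall =
    x , free-fromℕ< 2p<n vacant , inj₁ (x , EvenFromEnds-2* p≤m x x≡2p , claimed)
    where
    2p<n : 2 * p < n
    2p<n = s≤s (*-monoʳ-≤ 2 p≤m)
    x = fromℕ< 2p<n
    x≡2p : toℕ x ≡ 2 * p
    x≡2p = toℕ-fromℕ< 2p<n
    held : ∀ u → at S (toℕ u) ≡ true → u ∈ S ∪ ⁅ x ⁆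
    held u u∈S = p⊆p∪q ⁅ x ⁆ (at⇒∈ S u u∈S)
    claimed : ∀ u → InClosedNbhd (Path n) x u → u ∈ S ∪ ⁅ x ⁆
    claimed u (inj₁ refl) = x∈p∪q⁺ (inj₂ (x∈⁅x⁆ x))
    claimed u (inj₂ (inj₁ x+1≡u)) = beyond-right right-wall
      where
      beyond-right : p ≡ m ⊎ at S (suc (2 * p)) ≡ true → u ∈ S ∪ ⁅ x ⁆
      beyond-right (inj₁ refl)   = ⊥-elim (<-irrefl (trans (sym x+1≡u) (cong suc x≡2p)) (toℕ<n u))
      beyond-right (inj₂ 2p+1∈S) =
        held u (subst (λ i → at S i ≡ true) (trans (cong suc (sym x≡2p)) x+1≡u) 2p+1∈S)
    claimed u (inj₂ (inj₂ u+1≡x)) = beyond-left left-wall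
      where
      beyond-left : p ≡ 0 ⊎ at S (pred (2 * p)) ≡ true → u ∈ S ∪ ⁅ x ⁆
      beyond-left (inj₁ refl)   = ⊥-elim (1+n≢0 (trans u+1≡x x≡2p))
      beyond-left (inj₂ 2p-1∈S) =
        held u (subst (λ i → at S i ≡ true) (cong pred (trans (sym x≡2p) (sym u+1≡x))) 2p-1∈S)

  module Halving {k D S} (p t : ℕ) (p+t+1≤m : p + suc t ≤ m) (t+1<2^[1+k] : suc t < 2 ^ suc k)
    (vacant : Vacant D S (2 * p) (2 * (p + suc t)))
    (left-wall : p ≡ 0 ⊎ at S (pred (2 * p)) ≡ true)
    (right-wall : p + suc t ≡ m ⊎ at S (suc (2 * (p + suc t))) ≡ true) where

    c : ℕ
    c = p + ⌊ t /2⌋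

    1+c+⌈t/2⌉≡p+t+1 : suc c + ⌈ t /2⌉ ≡ p + suc t
    1+c+⌈t/2⌉≡p+t+1 = begin
      suc (p + ⌊ t /2⌋ + ⌈ t /2⌉)  ≡⟨ cong suc (+-assoc p ⌊ t /2⌋ ⌈ t /2⌉) ⟩
      suc (p + (⌊ t /2⌋ + ⌈ t /2⌉)) ≡⟨ cong (λ h → suc (p + h)) (⌊n/2⌋+⌈n/2⌉≡n t) ⟩
      suc (p + t)                    ≡⟨ sym (+-suc p t) ⟩
      p + suc t                      ∎
      where open ≡-Reasoning

    c<p+t+1 : c < p + suc t
    c<p+t+1 = subst (c <_) 1+c+⌈t/2⌉≡p+t+1 (s≤s (m≤m+n c ⌈ t /2⌉))

    ⌈t/2⌉<2^k : ⌈ t /2⌉ < 2 ^ k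
    ⌈t/2⌉<2^k = n<2*m⇒⌊n/2⌋<m t+1<2^[1+k]

    ⌊t/2⌋<2^k : ⌊ t /2⌋ < 2 ^ k
    ⌊t/2⌋<2^k = ≤-<-trans (⌊n/2⌋≤⌈n/2⌉ t) ⌈t/2⌉<2^k

    x<n : suc (2 * c) < n
    x<n = s≤s (*-monoʳ-< 2 (<-≤-trans c<p+t+1 p+t+1≤m))

    x : Fin n
    x = fromℕ< x<n

    x≡2c+1 : toℕ x ≡ suc (2 * c)
    x≡2c+1 = toℕ-fromℕ< x<n

    2c+1≤2[p+t+1] : suc (2 * c) ≤ 2 * (p + suc t)
    2c+1≤2[p+t+1] = <⇒≤ (m<n⇒1+2m<2n c<p+t+1)

    fx : Free (Path n) D S x
    fx = free-fromℕ< x<n (vacant (≤-trans (*-monoʳ-≤ 2 (m≤m+n p ⌊ t /2⌋)) (n≤1+n _)) 2c+1≤2[p+t+1])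

    2p<n : 2 * p < n
    2p<n = s≤s (*-monoʳ-≤ 2 (≤-trans (m≤m+n p (suc t)) p+t+1≤m))

    y₀ : Fin n
    y₀ = fromℕ< 2p<n

    fy₀ : Free (Path n) D (S ∪ ⁅ x ⁆) y₀
    fy₀ = free-fromℕ< 2p<n (free-playS {D = D} {S} (vacant ≤-refl (*-monoʳ-≤ 2 (m≤m+n p (suc t))))
                                        (λ x≡2p → even≢odd p c (trans (sym x≡2p) x≡2c+1)))

    wall-play : ∀ {A : Set} {i} → A ⊎ at S i ≡ true → A ⊎ at (S ∪ ⁅ x ⁆) i ≡ true
    wall-play (inj₁ a)   = inj₁ a
    wall-play (inj₂ i∈S) = inj₂ (at-⊆ {p = S} (p⊆p∪q ⁅ x ⁆) i∈S)

    2c<x : 2 * c < toℕ x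
    2c<x = subst (2 * c <_) (sym x≡2c+1) ≤-refl

    keep-left : ∀ {y} → toℕ x < toℕ y → Bracket k (D ∪ ⁅ y ⁆) (S ∪ ⁅ x ⁆)
    keep-left x<y = bracket p ⌊ t /2⌋ (≤-trans (<⇒≤ c<p+t+1) p+t+1≤m) ⌊t/2⌋<2^k
      (Vacant-play {D} {S} vacant ≤-refl (*-monoʳ-≤ 2 (<⇒≤ c<p+t+1)) (inj₂ 2c<x) (inj₂ (<-trans 2c<x x<y)))
      (wall-play left-wall) (inj₂ (at-∪⁅⁆-hit S x≡2c+1))

    x<2[c+1] : toℕ x < 2 * suc c
    x<2[c+1] = subst (_< 2 * suc c) (sym x≡2c+1) (m<n⇒1+2m<2n ≤-refl)

    keep-right : ∀ {y} → toℕ y < toℕ x → Bracket k (D ∪ ⁅ y ⁆) (S ∪ ⁅ x ⁆)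
    keep-right y<x = bracket (suc c) ⌈ t /2⌉ (subst (_≤ m) (sym 1+c+⌈t/2⌉≡p+t+1) p+t+1≤m) ⌈t/2⌉<2^k
      (Vacant-play {D} {S} vacant (*-monoʳ-≤ 2 (≤-trans (m≤m+n p ⌊ t /2⌋) (n≤1+n c)))
                   (≤-reflexive (cong (2 *_) 1+c+⌈t/2⌉≡p+t+1))
                   (inj₁ x<2[c+1]) (inj₁ (<-trans y<x x<2[c+1])))
      (inj₂ (at-∪⁅⁆-hit S (trans x≡2c+1 (cong pred (sym (*-suc 2 c))))))
      (subst (λ h → h ≡ m ⊎ at (S ∪ ⁅ x ⁆) (suc (2 * h)) ≡ true) (sym 1+c+⌈t/2⌉≡p+t+1) (wall-play right-wall))

    respond : ∀ y → Free (Path n) D (S ∪ ⁅ x ⁆) y → Bracket k (D ∪ ⁅ y ⁆) (S ∪ ⁅ x ⁆)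
    respond y (_ , y∉S∪⁅x⁆) with <-cmp (toℕ y) (toℕ x)
    ... | tri< y<x _ _ = keep-right y<x
    ... | tri≈ _ y≡x _ = ⊥-elim (y∉S∪⁅x⁆ (subst (_∈ S ∪ ⁅ x ⁆) (toℕ-injective (sym y≡x)) (x∈p∪q⁺ (inj₂ (x∈⁅x⁆ x)))))
    ... | tri> _ _ x<y = keep-left x<y

  bracket-wins : ∀ k {D S} → Bracket k D S → StallerWins (Path n) (EvenFromEnds n) (suc k) D S
  bracket-wins k {S = S} (bracket p zero p+0≤m _ vacant left-wall right-wall) =
    claim-walled p (subst (_≤ m) p+0≡p p+0≤m) (vacant ≤-refl (≤-reflexive (cong (2 *_) (sym p+0≡p))))
                 left-wall (subst (λ h → h ≡ m ⊎ at S (suc (2 * h)) ≡ true) p+0≡p right-wall)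
    where p+0≡p = +-identityʳ p
  bracket-wins zero    (bracket p (suc t) _ (s≤s ()) _ _ _)
  bracket-wins (suc k) {D} {S} (bracket p (suc t) p+t≤m t<2^k vacant left-wall right-wall) =
    x , fx , inj₂ ((y₀ , fy₀) , λ y fy → bracket-wins k (respond y fy))
    where open Halving {k} {D} {S} p t p+t≤m t<2^k vacant left-wall right-wall

  staller-wins : SGameWinWithin (Path n) (EvenFromEnds n) (suc ⌊log₂ n ⌋)
  staller-wins = bracket-wins ⌊log₂ n ⌋ (bracket 0 m ≤-refl m<2^⌊log₂n⌋
                                                 (λ {i} _ _ → at-⊥ {n} i , at-⊥ {n} i) (inj₁ refl) (inj₁ refl))
    where
    m<2^⌊log₂n⌋ : m < 2 ^ ⌊log₂ n ⌋
    m<2^⌊log₂n⌋ = 1+2m≤2n⇒m<n (<⇒≤ (n<2^[1+⌊log₂n⌋] n))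

module Pairing (m : ℕ) where

  n : ℕ
  n = suc (2 * m)

  InPair : ℕ → ℕ → Set
  InPair v i = v ≡ i ⊎ v ≡ suc i

  Near : ℕ → ℕ → Set
  Near v u = u ≡ v ⊎ u ≡ suc v ⊎ suc u ≡ v

  InPair-near : ∀ {v u i} → InPair v i → InPair u i → Near v u
  InPair-near (inj₁ refl) (inj₁ refl) = inj₁ refl
  InPair-near (inj₁ refl) (inj₂ refl) = inj₂ (inj₁ refl)
  InPair-near (inj₂ refl) (inj₁ refl) = inj₂ (inj₂ refl)
  InPair-near (inj₂ refl) (inj₂ refl) = inj₁ refl

  InPair-partner : ∀ {v i} → InPair v i →
                   ∃ λ q → InPair q i × q ≢ v × (∀ {u} → InPair u i → u ≡ v ⊎ u ≡ q)
  InPair-partner {i = i} (inj₁ refl) =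
    suc i , inj₂ refl , 1+n≢n , λ { (inj₁ refl) → inj₁ refl ; (inj₂ refl) → inj₂ refl }
  InPair-partner {i = i} (inj₂ refl) =
    i , inj₁ refl , 1+n≢n ∘ sym , λ { (inj₁ refl) → inj₂ refl ; (inj₂ refl) → inj₁ refl }

  InPair-bound : ∀ {v i} → InPair v i → suc i < n → v < n
  InPair-bound (inj₁ refl) 1+i<n = <-trans (n<1+n _) 1+i<n
  InPair-bound (inj₂ refl) 1+i<n = 1+i<n

  Dominated : Subset n → ℕ → Set
  Dominated D v = ∃ λ u → Near v u × at D u ≡ true

  PairUnplayed : Subset n → ℕ → Set
  PairUnplayed S i = ∀ {u} → InPair u i → at S u ≡ false

  PairHeld : Subset n → ℕ → Set
  PairHeld D i = ∃ λ u → InPair u i × at D u ≡ true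

  data PairIntact (D S : Subset n) (i : ℕ) : Set where
    unplayed : PairUnplayed S i → PairIntact D S i
    held     : PairHeld D i → PairIntact D S i

  -- Dominator's pairs are {2j, 2j+1} for j < a and {2j+1, 2j+2} for b ≤ j < m, each named
  -- by its smaller vertex; the even vertices 2a, …, 2b lie in no pair.
  Paired : ℕ → ℕ → ℕ → Set
  Paired a b i = (∃ λ j → i ≡ 2 * j × j < a) ⊎ (∃ λ j → i ≡ suc (2 * j) × b ≤ j × j < m)

  PairsIntact : ℕ → ℕ → Subset n → Subset n → Set
  PairsIntact a b D S = ∀ {i} → Paired a b i → PairIntact D S i

  Unplayed : Subset n → ℕ → ℕ → Set
  Unplayed S lo hi = ∀ {i} → lo ≤ i → i ≤ hi → at S i ≡ false

  Unplayed⇒PairUnplayed : ∀ {S lo hi i} → Unplayed S lo hi → lo ≤ i → suc i ≤ hi → PairUnplayed S i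
  Unplayed⇒PairUnplayed untouched lo≤i i<hi (inj₁ refl) = untouched lo≤i (<⇒≤ i<hi)
  Unplayed⇒PairUnplayed untouched lo≤i i<hi (inj₂ refl) = untouched (≤-trans lo≤i (n≤1+n _)) i<hi

  Paired-bound : ∀ {a b i} → a ≤ m → Paired a b i → suc i < n
  Paired-bound a≤m (inj₁ (j , refl , j<a))   = s≤s (*-monoʳ-< 2 (<-≤-trans j<a a≤m))
  Paired-bound _   (inj₂ (j , refl , _ , j<m)) = s≤s (m<n⇒1+2m<2n j<m)

  Paired⇒¬InPair-between : ∀ {a b i v} → Paired a b i → 2 * a ≤ v → v ≤ 2 * b → ¬ InPair v i
  Paired⇒¬InPair-between (inj₁ (j , refl , j<a)) 2a≤v _ v∈ =
    <⇒≱ (≤-<-trans (InPair⇒≤ v∈) (m<n⇒1+2m<2n j<a)) 2a≤v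
    where
    InPair⇒≤ : ∀ {v i} → InPair v i → v ≤ suc i
    InPair⇒≤ (inj₁ refl) = n≤1+n _
    InPair⇒≤ (inj₂ refl) = ≤-refl
  Paired⇒¬InPair-between (inj₂ (j , refl , b≤j , _)) _ v≤2b v∈ =
    <⇒≱ (<-≤-trans (s≤s (*-monoʳ-≤ 2 b≤j)) (InPair⇒≥ v∈)) v≤2b
    where
    InPair⇒≥ : ∀ {v i} → InPair v i → i ≤ v
    InPair⇒≥ (inj₁ refl) = ≤-refl
    InPair⇒≥ (inj₂ refl) = n≤1+n _

  Paired-adjacent : ∀ {a b i} → a ≤ b → Paired a b i → ¬ Paired a b (suc i)
  Paired-adjacent _ (inj₁ (j , refl , _)) (inj₁ (j′ , 2j+1≡2j′ , _)) = even≢odd j′ j (sym 2j+1≡2j′)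
  Paired-adjacent {b = b} a≤b (inj₁ (j , refl , j<a)) (inj₂ (j′ , 2j+1≡2j′+1 , b≤j′ , _)) =
    <⇒≱ j<a (≤-trans a≤b (subst (b ≤_) (sym (*-cancelˡ-≡ j j′ 2 (suc-injective 2j+1≡2j′+1))) b≤j′))
  Paired-adjacent a≤b (inj₂ (j , refl , b≤j , _)) (inj₁ (j′ , 2j+2≡2j′ , j′<a)) =
    <⇒≱ j′<a (≤-trans a≤b (≤-trans b≤j (≤-trans (n≤1+n j) (≤-reflexive j+1≡j′))))
    where j+1≡j′ = *-cancelˡ-≡ (suc j) j′ 2 (trans (*-suc 2 j) 2j+2≡2j′)
  Paired-adjacent _ (inj₂ (j , refl , _)) (inj₂ (j′ , 2j+2≡2j′+1 , _)) =
    even≢odd j′ j (sym (suc-injective 2j+2≡2j′+1))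

  Paired-unique : ∀ {a b i i′ v} → a ≤ b → Paired a b i → Paired a b i′ → InPair v i → InPair v i′ → i ≡ i′
  Paired-unique _   _  _   (inj₁ refl) (inj₁ refl)    = refl
  Paired-unique _   _  _   (inj₂ refl) (inj₂ i+1≡i′+1) = suc-injective i+1≡i′+1
  Paired-unique a≤b pi pi′ (inj₁ refl) (inj₂ refl)    = ⊥-elim (Paired-adjacent a≤b pi′ pi)
  Paired-unique a≤b pi pi′ (inj₂ refl) (inj₁ refl)    = ⊥-elim (Paired-adjacent a≤b pi pi′)

  outside-Paired : ∀ {a b v} → b ≤ m → v < n → Outside (2 * a) (2 * b) v → ∃ λ i → Paired a b i × InPair v i
  outside-Paired {a} {b} {v} b≤m v<n out with parity v | out
  ... | inj₁ (j , refl)     | inj₁ 2j<2a =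
    2 * j , inj₁ (j , refl , *-cancelˡ-< 2 j a 2j<2a) , inj₁ refl
  ... | inj₁ (zero , refl)  | inj₂ ()
  ... | inj₁ (suc j , refl) | inj₂ 2b<2j+2 =
    suc (2 * j) , inj₂ (j , refl , s≤s⁻¹ (*-cancelˡ-< 2 b (suc j) 2b<2j+2) , *-cancelˡ-≤ 2 (s≤s⁻¹ v<n)) ,
    inj₂ (*-suc 2 j)
  ... | inj₂ (j , refl)     | inj₁ 2j+1<2a =
    2 * j , inj₁ (j , refl , 1+2m≤2n⇒m<n (<⇒≤ 2j+1<2a)) , inj₂ refl
  ... | inj₂ (j , refl)     | inj₂ 2b<2j+1 =
    suc (2 * j) , inj₂ (j , refl , 2m<1+2n⇒m≤n 2b<2j+1 , *-cancelˡ-< 2 j m (s≤s⁻¹ v<n)) , inj₁ refl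

  -- Pairs inside an unplayed stretch are intact, so the pairing may be re-split anywhere in it.
  regroup : ∀ {a b c d D S} → PairsIntact c d D S → Unplayed S (2 * c) (2 * d) → a ≤ d → c ≤ b →
            PairsIntact a b D S
  regroup {c = c} {S = S} intact untouched a≤d c≤b (inj₁ (j , refl , j<a)) with j <? c
  ... | yes j<c = intact (inj₁ (j , refl , j<c))
  ... | no  j≮c = unplayed (Unplayed⇒PairUnplayed {S} untouched (*-monoʳ-≤ 2 (≮⇒≥ j≮c))
                                                      (<⇒≤ (m<n⇒1+2m<2n (<-≤-trans j<a a≤d))))
  regroup {d = d} {S = S} intact untouched a≤d c≤b (inj₂ (j , refl , b≤j , j<m)) with d ≤? j
  ... | yes d≤j = intact (inj₂ (j , refl , d≤j , j<m))
  ... | no  d≰j = unplayed (Unplayed⇒PairUnplayed {S} untouched (≤-trans (*-monoʳ-≤ 2 (≤-trans c≤b b≤j)) (n≤1+n _))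
                                                      (m<n⇒1+2m<2n (≰⇒> d≰j)))

  PairIntact-mono : ∀ {D D′ S i} → D ⊆ D′ → PairIntact D S i → PairIntact D′ S i
  PairIntact-mono _        (unplayed S∌pair)      = unplayed S∌pair
  PairIntact-mono {D} D⊆D′ (held (u , u∈ , u∈D)) = held (u , u∈ , at-⊆ {p = D} D⊆D′ u∈D)

  PairsIntact-mono : ∀ {a b D D′ S} → D ⊆ D′ → PairsIntact a b D S → PairsIntact a b D′ S
  PairsIntact-mono D⊆D′ intact pi = PairIntact-mono D⊆D′ (intact pi)

  PairIntact-play : ∀ {D S x i} → ¬ InPair (toℕ x) i → PairIntact D S i → PairIntact D (S ∪ ⁅ x ⁆) i
  PairIntact-play {S = S} {i = i} x∉ (unplayed S∌pair) =
    unplayed λ u∈ → at-∪⁅⁆-miss {p = S} (S∌pair u∈) (λ x≡u → x∉ (subst (λ v → InPair v i) (sym x≡u) u∈))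
  PairIntact-play _ (held D∋pair) = held D∋pair

  PairsIntact-play-between : ∀ {a b D S x} → 2 * a ≤ toℕ x → toℕ x ≤ 2 * b →
                             PairsIntact a b D S → PairsIntact a b D (S ∪ ⁅ x ⁆)
  PairsIntact-play-between 2a≤x x≤2b intact pi =
    PairIntact-play (Paired⇒¬InPair-between pi 2a≤x x≤2b) (intact pi)

  PairsIntact-play-paired : ∀ {a b D S x i₀} → a ≤ b → Paired a b i₀ → InPair (toℕ x) i₀ → PairHeld D i₀ →
                            PairsIntact a b D S → PairsIntact a b D (S ∪ ⁅ x ⁆)
  PairsIntact-play-paired {i₀ = i₀} a≤b pi₀ x∈ D∋pair intact {i} pi with i ≟ i₀
  ... | yes refl = held D∋pair
  ... | no  i≢i₀ = PairIntact-play (λ x∈i → i≢i₀ (Paired-unique a≤b pi pi₀ x∈i x∈)) (intact pi)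

  data Guarded (D S : Subset n) (v : ℕ) : Set where
    by-pair      : ∀ {i} → InPair v i → suc i < n → PairUnplayed S i → Guarded D S v
    by-dominator : Dominated D v → Guarded D S v

  PairIntact⇒Guarded : ∀ {D S v i} → InPair v i → suc i < n → PairIntact D S i → Guarded D S v
  PairIntact⇒Guarded v∈ 1+i<n (unplayed S∌pair)      = by-pair v∈ 1+i<n S∌pair
  PairIntact⇒Guarded v∈ _     (held (u , u∈ , u∈D)) = by-dominator (u , InPair-near v∈ u∈ , u∈D)

  outside-Guarded : ∀ {a b D S v} → a ≤ b → b ≤ m → PairsIntact a b D S → v < n →
                    Outside (2 * a) (2 * b) v → Guarded D S v
  outside-Guarded a≤b b≤m intact v<n out with outside-Paired b≤m v<n out
  ... | i , pi , v∈ = PairIntact⇒Guarded v∈ (Paired-bound (≤-trans a≤b b≤m) pi) (intact pi)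

  pair-within : ∀ {lo hi v} → lo < hi → lo ≤ v → v ≤ hi → ∃ λ i → lo ≤ i × suc i ≤ hi × InPair v i
  pair-within {hi = suc h} {v} (s≤s lo≤h) lo≤v v≤hi with m≤n⇒m<n∨m≡n v≤hi
  ... | inj₁ v<hi = v , lo≤v , v<hi , inj₁ refl
  ... | inj₂ refl = h , lo≤h , ≤-refl , inj₂ refl

  between-Guarded : ∀ {D S lo hi v} → lo < hi → hi < n → Unplayed S lo hi → lo ≤ v → v ≤ hi → Guarded D S v
  between-Guarded {S = S} lo<hi hi<n untouched lo≤v v≤hi with pair-within lo<hi lo≤v v≤hi
  ... | i , lo≤i , 1+i≤hi , v∈ = by-pair v∈ (≤-<-trans 1+i≤hi hi<n) (Unplayed⇒PairUnplayed {S} untouched lo≤i 1+i≤hi)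

  position : ∀ lo hi v → Outside lo hi v ⊎ (lo ≤ v × v ≤ hi)
  position lo hi v with v <? lo | hi <? v
  ... | yes v<lo | _        = inj₁ (inj₁ v<lo)
  ... | no  _    | yes hi<v = inj₁ (inj₂ hi<v)
  ... | no  v≮lo | no  hi≮v = inj₂ (≮⇒≥ v≮lo , ≮⇒≥ hi≮v)

  record Gap (k : ℕ) (D S : Subset n) : Set where
    constructor gap
    field
      p w       : ℕ
      p+w≤m     : p + w ≤ m
      intact    : PairsIntact p (p + w) D S
      untouched : Unplayed S (2 * p) (2 * (p + w))
      long      : 2 ^ k ≤ suc (2 * w)

  record Settled (D S : Subset n) : Set where
    constructor settled
    field
      p         : ℕ
      p≤m       : p ≤ m
      intact    : PairsIntact p p D S
      dominated : Dominated D (2 * p)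

  Safe : ℕ → Subset n → Subset n → Set
  Safe k D S = Gap k D S ⊎ Settled D S

  Safe⇒Guarded : ∀ {k D S v} → Safe (suc k) D S → v < n → Guarded D S v
  Safe⇒Guarded {k} {v = v} (inj₁ (gap p w p+w≤m intact untouched long)) v<n with position (2 * p) (2 * (p + w)) v
  ... | inj₁ out            = outside-Guarded (m≤m+n p w) p+w≤m intact v<n out
  ... | inj₂ (2p≤v , v≤2p+2w) =
    between-Guarded (*-monoʳ-< 2 (m<m+n p (2^[1+k]≤1+2w⇒0<w {k} long))) (s≤s (*-monoʳ-≤ 2 p+w≤m)) untouched 2p≤v v≤2p+2w
  Safe⇒Guarded {v = v} (inj₂ (settled p p≤m intact dominated)) v<n with position (2 * p) (2 * p) v
  ... | inj₁ out = outside-Guarded ≤-refl p≤m intact v<n out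
  ... | inj₂ (2p≤v , v≤2p) rewrite ≤-antisym v≤2p 2p≤v = by-dominator dominated

  Near⇒InClosedNbhd : ∀ {v u : Fin n} → Near (toℕ v) (toℕ u) → InClosedNbhd (Path n) v u
  Near⇒InClosedNbhd (inj₁ u≡v)           = inj₁ (toℕ-injective u≡v)
  Near⇒InClosedNbhd (inj₂ (inj₁ u≡v+1)) = inj₂ (inj₁ (sym u≡v+1))
  Near⇒InClosedNbhd (inj₂ (inj₂ u+1≡v)) = inj₂ (inj₂ u+1≡v)

  unclaimed : ∀ {S x u} (v : Fin n) → u < n → Near (toℕ v) u → at S u ≡ false → toℕ x ≢ u →
              ¬ (∀ w → InClosedNbhd (Path n) v w → w ∈ S ∪ ⁅ x ⁆)
  unclaimed {S} {x} v u<n near u∉S x≢u claimed =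
    true≢false (trans (sym (trans (sym (at-fromℕ< (S ∪ ⁅ x ⁆) u<n)) (∈⇒at w∈S∪⁅x⁆)))
                      (at-∪⁅⁆-miss {p = S} u∉S x≢u))
    where
    w∈S∪⁅x⁆ = claimed (fromℕ< u<n) (Near⇒InClosedNbhd (subst (Near (toℕ v)) (sym (toℕ-fromℕ< u<n)) near))

  Guarded⇒unclaimed : ∀ {D S x} (v : Fin n) → Disjoint D S → x ∉ D → Guarded D S (toℕ v) →
                      ¬ (∀ w → InClosedNbhd (Path n) v w → w ∈ S ∪ ⁅ x ⁆)
  Guarded⇒unclaimed {x = x} v _ _ (by-pair {i} v∈ 1+i<n S∌pair) with toℕ x ≟ i
  ... | yes x≡i = unclaimed v 1+i<n (InPair-near v∈ (inj₂ refl)) (S∌pair (inj₂ refl))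
                            (λ x≡1+i → 1+n≢n (trans (sym x≡1+i) x≡i))
  ... | no  x≢i = unclaimed v (<-trans (n<1+n i) 1+i<n) (InPair-near v∈ (inj₁ refl)) (S∌pair (inj₁ refl)) x≢i
  Guarded⇒unclaimed {D} v D∩S=∅ x∉D (by-dominator (u , near , u∈D)) =
    unclaimed v (at⇒< D u∈D) near (Disjoint-at {D = D} D∩S=∅ u∈D)
              (λ { refl → true≢false (trans (sym u∈D) (∉⇒at x∉D)) })

  blocks : ∀ {P : Fin n → Set} {k D S} → Disjoint D S → Safe (suc k) D S →
           ∀ x → Free (Path n) D S x → ¬ Claims (Path n) P (S ∪ ⁅ x ⁆)
  blocks D∩S=∅ safe x (x∉D , _) (v , _ , claimed) =
    Guarded⇒unclaimed v D∩S=∅ x∉D (Safe⇒Guarded safe (toℕ<n v)) claimed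

  Dominated-mono : ∀ {D D′ v} → D ⊆ D′ → Dominated D v → Dominated D′ v
  Dominated-mono {D} D⊆D′ (u , near , u∈D) = u , near , at-⊆ {p = D} D⊆D′ u∈D

  Unplayed-play : ∀ {S x lo hi lo′ hi′} → Unplayed S lo hi → lo ≤ lo′ → hi′ ≤ hi →
                  Outside lo′ hi′ (toℕ x) → Unplayed (S ∪ ⁅ x ⁆) lo′ hi′
  Unplayed-play {S} untouched lo≤lo′ hi′≤hi x-out lo′≤i i≤hi′ =
    at-∪⁅⁆-miss {p = S} (untouched (≤-trans lo≤lo′ lo′≤i) (≤-trans i≤hi′ hi′≤hi)) (Outside⇒≢ x-out lo′≤i i≤hi′)

  Reply : ℕ → Subset n → Subset n → Fin n → Set
  Reply k D S x = (∃ λ y → Free (Path n) D (S ∪ ⁅ x ⁆) y) →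
                  ∃ λ y → Free (Path n) D (S ∪ ⁅ x ⁆) y × Safe k (D ∪ ⁅ y ⁆) (S ∪ ⁅ x ⁆)

  reply-anywhere : ∀ {k D S x} → (∀ {D′} → D ⊆ D′ → Safe k D′ (S ∪ ⁅ x ⁆)) → Reply k D S x
  reply-anywhere safe (y , fy) = y , fy , safe (p⊆p∪q ⁅ y ⁆)

  reply-at : ∀ {k D S x q} → q < n → at D q ≡ true ⊎ at (S ∪ ⁅ x ⁆) q ≡ false →
             (∀ {D′} → D ⊆ D′ → at D′ q ≡ true → Safe k D′ (S ∪ ⁅ x ⁆)) → Reply k D S x
  reply-at {D = D} _ (inj₁ q∈D) safe = reply-anywhere (λ D⊆D′ → safe D⊆D′ (at-⊆ {p = D} D⊆D′ q∈D))
  reply-at {D = D} {q = q} q<n (inj₂ q∉S′) safe replies with at D q in q?D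
  ... | true  = reply-at q<n (inj₁ q?D) safe replies
  ... | false = y , free-fromℕ< q<n (q?D , q∉S′) , safe (p⊆p∪q ⁅ y ⁆) (at-∪⁅⁆-hit D (toℕ-fromℕ< q<n))
    where y = fromℕ< q<n

  reply-outside : ∀ {k a b D S x} → a ≤ b → b ≤ m → PairsIntact a b D S →
                  Free (Path n) D S x → Outside (2 * a) (2 * b) (toℕ x) →
                  (∀ {D′} → D ⊆ D′ → PairsIntact a b D′ (S ∪ ⁅ x ⁆) → Safe k D′ (S ∪ ⁅ x ⁆)) → Reply k D S x
  reply-outside {D = D} {S} {x} a≤b b≤m intact (x∉D , _) out safe with outside-Paired b≤m (toℕ<n x) out
  ... | i₀ , pi₀ , x∈ with InPair-partner x∈
  ...   | q , q∈ , q≢x , pair≡⁅x,q⁆ =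
    reply-at (InPair-bound q∈ (Paired-bound (≤-trans a≤b b≤m) pi₀)) (partner-free (intact pi₀))
      (λ D⊆D′ q∈D′ → safe D⊆D′ (PairsIntact-play-paired a≤b pi₀ x∈ (q , q∈ , q∈D′) (PairsIntact-mono D⊆D′ intact)))
    where
    partner-free : PairIntact D S i₀ → at D q ≡ true ⊎ at (S ∪ ⁅ x ⁆) q ≡ false
    partner-free (unplayed S∌pair) = inj₂ (at-∪⁅⁆-miss {p = S} (S∌pair q∈) (q≢x ∘ sym))
    partner-free (held (u , u∈ , u∈D)) with pair≡⁅x,q⁆ u∈
    ... | inj₁ refl = ⊥-elim (true≢false (trans (sym u∈D) (∉⇒at x∉D)))
    ... | inj₂ refl = inj₁ u∈D

  settled-reply : ∀ {k D S x} → Settled D S → Free (Path n) D S x → Reply k D S x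
  settled-reply {x = x} (settled p p≤m intact dominated) fx with position (2 * p) (2 * p) (toℕ x)
  ... | inj₁ out = reply-outside ≤-refl p≤m intact fx out
                     (λ D⊆D′ intact′ → inj₂ (settled p p≤m intact′ (Dominated-mono D⊆D′ dominated)))
  ... | inj₂ (2p≤x , x≤2p) = reply-anywhere
                     (λ D⊆D′ → inj₂ (settled p p≤m (PairsIntact-mono D⊆D′ (PairsIntact-play-between 2p≤x x≤2p intact))
                                                  (Dominated-mono D⊆D′ dominated)))

  module GapReply {k D S x} (g : Gap (suc k) D S) (fx : Free (Path n) D S x) where
    open Gap g

    hi<n : 2 * (p + w) < n
    hi<n = s≤s (*-monoʳ-≤ 2 p+w≤m)

    outside-reply : Outside (2 * p) (2 * (p + w)) (toℕ x) → Reply k D S x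
    outside-reply out = reply-outside (m≤m+n p w) p+w≤m intact fx out
      (λ D⊆D′ intact′ → inj₁ (gap p w p+w≤m intact′ (Unplayed-play {S} untouched ≤-refl ≤-refl out)
                                  (≤-trans (m≤m+n (2 ^ k) _) long)))

    even-reply : ∀ {j} → toℕ x ≡ 2 * j → 2 * p ≤ toℕ x → toℕ x ≤ 2 * (p + w) → Reply k D S x
    even-reply {j} x≡2j 2p≤x x≤hi with pair-within (*-monoʳ-< 2 (m<m+n p (2^[1+k]≤1+2w⇒0<w {k} long))) 2p≤x x≤hi
    ... | i , 2p≤i , 1+i≤hi , x∈ with InPair-partner x∈
    ...   | q , q∈ , q≢x , _ =
      reply-at (InPair-bound q∈ (≤-<-trans 1+i≤hi hi<n))
        (inj₂ (at-∪⁅⁆-miss {p = S} (Unplayed⇒PairUnplayed {S} untouched 2p≤i 1+i≤hi q∈) (q≢x ∘ sym)))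
        (λ D⊆D′ q∈D′ → inj₂ (settled j (≤-trans j≤p+w p+w≤m) (intact′ D⊆D′)
                                      (q , subst (λ v → Near v q) x≡2j (InPair-near x∈ q∈) , q∈D′)))
      where
      p≤j : p ≤ j
      p≤j = *-cancelˡ-≤ 2 (subst (2 * p ≤_) x≡2j 2p≤x)
      j≤p+w : j ≤ p + w
      j≤p+w = *-cancelˡ-≤ 2 (subst (_≤ 2 * (p + w)) x≡2j x≤hi)
      intact′ : ∀ {D′} → D ⊆ D′ → PairsIntact j j D′ (S ∪ ⁅ x ⁆)
      intact′ D⊆D′ = PairsIntact-mono D⊆D′ (PairsIntact-play-between (≤-reflexive (sym x≡2j)) (≤-reflexive x≡2j)
                                                                     (regroup {S = S} intact untouched j≤p+w p≤j))

    module _ {j s r} (x≡2j+1 : toℕ x ≡ suc (2 * j)) (p+s≡j : p + s ≡ j) (j+1+r≡p+w : suc j + r ≡ p + w) where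

      long′ : 2 ^ suc k ≤ suc (2 * suc (s + r))
      long′ = subst (λ h → 2 ^ suc k ≤ suc (2 * h)) w≡1+s+r long
        where
        open ≡-Reasoning
        w≡1+s+r : w ≡ suc (s + r)
        w≡1+s+r = +-cancelˡ-≡ p w (suc (s + r)) (begin
          p + w              ≡⟨ sym j+1+r≡p+w ⟩
          suc j + r          ≡⟨ cong (λ h → suc h + r) (sym p+s≡j) ⟩
          suc (p + s + r)    ≡⟨ cong suc (+-assoc p s r) ⟩
          suc (p + (s + r))  ≡⟨ sym (+-suc p (s + r)) ⟩
          p + suc (s + r)    ∎)

      p≤j : p ≤ j
      p≤j = subst (p ≤_) p+s≡j (m≤m+n p s)

      j<p+w : j < p + w
      j<p+w = subst (j <_) j+1+r≡p+w (s≤s (m≤m+n j r))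

      j<m : j < m
      j<m = <-≤-trans j<p+w p+w≤m

      keep-left : r ≤ s → Reply k D S x
      keep-left r≤s = reply-at (≤-<-trans q≤hi hi<n) (inj₂ q∉S∪⁅x⁆)
        (λ D⊆D′ q∈D′ → inj₁ (gap p s p+s≤m (intact′ D⊆D′ q∈D′) untouched′ (longer-half {k} long′ r≤s)))
        where
        q = suc (suc (2 * j))
        q≤hi : q ≤ 2 * (p + w)
        q≤hi = m<n⇒1+2m<2n j<p+w
        q∉S∪⁅x⁆ : at (S ∪ ⁅ x ⁆) q ≡ false
        q∉S∪⁅x⁆ = at-∪⁅⁆-miss {p = S} (untouched (≤-trans (*-monoʳ-≤ 2 p≤j) (≤-trans (n≤1+n _) (n≤1+n _))) q≤hi)
                                      (λ x≡q → 1+n≢n (trans (sym x≡q) x≡2j+1))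
        p+s≤m : p + s ≤ m
        p+s≤m = subst (_≤ m) (sym p+s≡j) (<⇒≤ j<m)
        intact′ : ∀ {D′} → D ⊆ D′ → at D′ q ≡ true → PairsIntact p (p + s) D′ (S ∪ ⁅ x ⁆)
        intact′ D⊆D′ q∈D′ =
          PairsIntact-play-paired (m≤m+n p s) (inj₂ (j , refl , ≤-reflexive p+s≡j , j<m)) (inj₁ x≡2j+1)
            (q , inj₂ refl , q∈D′) (PairsIntact-mono D⊆D′ (regroup {S = S} intact untouched (m≤m+n p w) (m≤m+n p s)))
        untouched′ : Unplayed (S ∪ ⁅ x ⁆) (2 * p) (2 * (p + s))
        untouched′ = Unplayed-play {S} untouched ≤-refl (*-monoʳ-≤ 2 (subst (_≤ p + w) (sym p+s≡j) (<⇒≤ j<p+w)))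
                       (inj₂ (subst₂ _<_ (cong (2 *_) (sym p+s≡j)) (sym x≡2j+1) ≤-refl))

      keep-right : s ≤ r → Reply k D S x
      keep-right s≤r = reply-at (s≤s (*-monoʳ-≤ 2 (<⇒≤ j<m))) (inj₂ q∉S∪⁅x⁆)
        (λ D⊆D′ q∈D′ → inj₁ (gap (suc j) r j+1+r≤m (intact′ D⊆D′ q∈D′) untouched′
                                  (longer-half {k} (subst (λ h → 2 ^ suc k ≤ suc (2 * suc h)) (+-comm s r) long′) s≤r)))
        where
        q = 2 * j
        q∉S∪⁅x⁆ : at (S ∪ ⁅ x ⁆) q ≡ false
        q∉S∪⁅x⁆ = at-∪⁅⁆-miss {p = S} (untouched (*-monoʳ-≤ 2 p≤j) (*-monoʳ-≤ 2 (<⇒≤ j<p+w)))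
                                      (λ x≡q → even≢odd j j (trans (sym x≡q) x≡2j+1))
        j+1+r≤m : suc j + r ≤ m
        j+1+r≤m = subst (_≤ m) (sym j+1+r≡p+w) p+w≤m
        intact′ : ∀ {D′} → D ⊆ D′ → at D′ q ≡ true → PairsIntact (suc j) (suc j + r) D′ (S ∪ ⁅ x ⁆)
        intact′ D⊆D′ q∈D′ =
          PairsIntact-play-paired (m≤m+n (suc j) r) (inj₁ (j , refl , n<1+n j)) (inj₂ x≡2j+1)
            (q , inj₁ refl , q∈D′)
            (PairsIntact-mono D⊆D′ (regroup {S = S} intact untouched j<p+w
                                             (≤-trans p≤j (≤-trans (n≤1+n j) (m≤m+n (suc j) r)))))
        untouched′ : Unplayed (S ∪ ⁅ x ⁆) (2 * suc j) (2 * (suc j + r))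
        untouched′ = Unplayed-play {S} untouched (*-monoʳ-≤ 2 (≤-trans p≤j (n≤1+n j)))
                       (≤-reflexive (cong (2 *_) j+1+r≡p+w))
                       (inj₁ (subst (_< 2 * suc j) (sym x≡2j+1) (m<n⇒1+2m<2n (n<1+n j))))

    odd-reply : ∀ {j} → toℕ x ≡ suc (2 * j) → 2 * p ≤ toℕ x → toℕ x ≤ 2 * (p + w) → Reply k D S x
    odd-reply {j} x≡2j+1 2p≤x x≤hi
      with m≤n⇒∃[o]m+o≡n (2m≤1+2n⇒m≤n {p} {j} (subst (2 * p ≤_) x≡2j+1 2p≤x))
         | m≤n⇒∃[o]m+o≡n (1+2m≤2n⇒m<n {j} {p + w} (subst (_≤ 2 * (p + w)) x≡2j+1 x≤hi))
    ... | s , p+s≡j | r , j+1+r≡p+w with ≤-total r s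
    ...   | inj₁ r≤s = keep-left  x≡2j+1 p+s≡j j+1+r≡p+w r≤s
    ...   | inj₂ s≤r = keep-right x≡2j+1 p+s≡j j+1+r≡p+w s≤r

    gap-reply : Reply k D S x
    gap-reply with position (2 * p) (2 * (p + w)) (toℕ x)
    ... | inj₁ out = outside-reply out
    ... | inj₂ (2p≤x , x≤hi) with parity (toℕ x)
    ...   | inj₁ (j , x≡2j)   = even-reply {j} x≡2j 2p≤x x≤hi
    ...   | inj₂ (j , x≡2j+1) = odd-reply {j} x≡2j+1 2p≤x x≤hi

  reply : ∀ {k D S} → Safe (suc k) D S → ∀ x → Free (Path n) D S x → Reply k D S x
  reply (inj₁ g) _ fx = GapReply.gap-reply g fx
  reply (inj₂ s) _ fx = settled-reply s fx

  initial : ∀ {k} → 2 ^ k ≤ n → Safe k ⊥ ⊥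
  initial 2^k≤n = inj₁ (gap 0 m ≤-refl no-pairs (λ {i} _ _ → at-⊥ {n} i) 2^k≤n)
    where
    no-pairs : PairsIntact 0 m ⊥ ⊥
    no-pairs (inj₂ (_ , _ , m≤j , j<m)) = ⊥-elim (<⇒≱ j<m m≤j)

  dominator-survives : ∀ {P : Fin n → Set} j → j ≤ ⌊log₂ n ⌋ → ¬ SGameWinWithin (Path n) P j
  dominator-survives {P} j j≤⌊log₂n⌋ =
    Safe⇒¬StallerWins (Path n) P Safe (blocks {P}) reply j (λ v∈⊥ _ → ∉⊥ v∈⊥)
      (initial (≤-trans (^-monoʳ-≤ 2 j≤⌊log₂n⌋) (2^⌊log₂n⌋≤n n (s≤s z≤n))))

theorem5p2 : (n : ℕ) → Odd n →
    γ'SMB≡ (Path n) (suc ⌊log₂ n ⌋)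
    × SGameWinWithin (Path n) (EvenFromEnds n) (suc ⌊log₂ n ⌋)
theorem5p2 _ (m , refl) =
  (StallerWins-mono (λ _ → tt) staller-wins , λ j j<1+⌊log₂n⌋ → dominator-survives j (s≤s⁻¹ j<1+⌊log₂n⌋)) ,
  staller-wins
  where
  open Bisection m using (staller-wins)
  open Pairing m using (dominator-survives)
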